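{- Let $n,k$ be integers with $2 \le k \le n$, and let $c$ be a $2$-coloring of the edges of $Q_n$. Consider the following randomized procedure: choose an antipodal geodesic $P=(v_0,v_1,\dots,v_n)$ of $Q_n$ uniformly at random; let $m=\lfloor n/k\rfloor$ and split $P$ into chunks $P_i=(v_{ki},\dots,v_{k(i+1)})$ for $0\le i<m$, plus a final chunk $(v_{km},\dots,v_n)$ if $n \bmod k \neq 0$. For $i=0,1,\dots,m-1$ in order, replace $P_i$ by a geodesic from $v_{ki}$ to $v_{k(i+1)}$ having the minimum possible number of color changes under $c$, where, if $i>0$, among such minimizing geodesics one starting with an edge of the same color as the last edge of the (already replaced) chunk $P_{i-1}$ is chosen whenever one exists. The final chunk is left unchanged. Then the expected number of color changes of the resulting antipodal geodesic is at most \[ \lfloor n/k\rfloor \cdot \hat f(k) + \lfloor n/k\rfloor + (n \bmod k). \]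
   Context: $Q_n$ is the hypercube graph on $\{0,1\}^n$ (edges between vertices differing in exactly one coordinate); $\bar u$ denotes the vertex obtained from $u$ by complementing all coordinates; an antipodal geodesic is a path of length $n$ from some $u$ to $\bar u$; a geodesic is a shortest path. The number of color changes of a path is the number of internal vertices of the path whose two path-edges have different colors. For a $2$-coloring $c$ (colors red/blue) of the edges of $Q_k$ and a vertex $u$, let $s_{c,u,\bar u}$ be the minimum number of color changes over all geodesics from $u$ to $\bar u$; let $s^r_{c,u,\bar u}$ (resp. $s^b_{c,u,\bar u}$) be the minimum over such geodesics whose first edge is red (resp. blue), and $s'_{c,u,\bar u}=\max(s^r_{c,u,\bar u},s^b_{c,u,\bar u})$. Define \[\hat f(k)=\max_{c}\ \frac{1}{2^k}\sum_{u\in V(Q_k)} \min\big(s_{c,u,\bar u},\ s'_{c,u,\bar u}-1\big),\] the maximum over all $2$-colorings $c$ of the edges of $Q_k$. -}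

module Defs where

open import Data.Nat using (ℕ; zero; suc; _+_; _*_; _≤_; _<_)
open import Data.Bool using (Bool; true; false; not; if_then_else_)
open import Data.Bool.Properties using () renaming (_≟_ to _≟B_)
open import Data.Fin using (Fin)
open import Data.Vec using (Vec; []; _∷_; lookup; _[_]≔_)
import Data.Vec as V
open import Data.List using (List; []; _∷_; length; take; drop; map; head; last; _++_; concat; upTo)
import Data.List as L
open import Data.Maybe using (Maybe; just; nothing)
open import Data.Product using (Σ; ∃; _×_; _,_)
open import Data.Sum using (_⊎_)
open import Data.Integer as ℤ using (ℤ; +_)
open import Relation.Binary.PropositionalEquality using (_≡_; _≢_)
open import Relation.Nullary using (¬_; does)

-- The hypercube Q_n : vertices are bit-vectors of length n,
-- u ~ w iff they differ in exactly one coordinate.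

Vertex : ℕ → Set
Vertex n = Vec Bool n

flipV : ∀ {n} → Vertex n → Fin n → Vertex n
flipV v i = v [ i ]≔ not (lookup v i)

compl : ∀ {n} → Vertex n → Vertex n
compl = V.map not

allVerts : (n : ℕ) → List (Vertex n)
allVerts zero    = [] ∷ []
allVerts (suc n) = map (false ∷_) (allVerts n) ++ map (true ∷_) (allVerts n)

-- A walk in Q_n is a start vertex together with the
-- list of directions traversed; the walk (u , i₁ ∷ … ∷ iₗ) visits
-- u , flipV u i₁ , flipV (flipV u i₁) i₂ , …  (every walk of Q_n arises
-- uniquely in this way).

endV : ∀ {n} → Vertex n → List (Fin n) → Vertex n
endV u []       = u
endV u (i ∷ is) = endV (flipV u i) is

IsGeodesic : ∀ {n} → Vertex n → Vertex n → List (Fin n) → Set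
IsGeodesic u w ds =
  endV u ds ≡ w × (∀ ds' → endV u ds' ≡ w → length ds ≤ length ds')

IsAntipodalGeodesic : ∀ {n} → Vertex n × List (Fin n) → Set
IsAntipodalGeodesic (u , ds) = IsGeodesic u (compl u) ds

-- 2-colourings of the edges of Q_n (true = red, false = blue).
-- The edge {v , flipV v i} is identified with the pair (v with
-- coordinate i set to false , i); a colouring is an arbitrary function
-- on such pairs (values at pairs whose vertex has coordinate i = true
-- are irrelevant).

Coloring : ℕ → Set
Coloring n = Vertex n → Fin n → Bool

edgeCol : ∀ {n} → Coloring n → Vertex n → Fin n → Bool
edgeCol c v i = c (v [ i ]≔ false) i

colors : ∀ {n} → Coloring n → Vertex n → List (Fin n) → List Bool
colors c v []       = []
colors c v (i ∷ is) = edgeCol c v i ∷ colors c (flipV v i) is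

changes : List Bool → ℕ
changes (a ∷ b ∷ r) = (if does (a ≟B b) then 0 else 1) + changes (b ∷ r)
changes _           = 0

cc : ∀ {n} → Coloring n → Vertex n → List (Fin n) → ℕ
cc c u ds = changes (colors c u ds)

firstCol : ∀ {n} → Coloring n → Vertex n → List (Fin n) → Maybe Bool
firstCol c u ds = head (colors c u ds)

lastCol : ∀ {n} → Coloring n → Vertex n → List (Fin n) → Maybe Bool
lastCol c u ds = last (colors c u ds)

MinOver : ∀ {n} → (List (Fin n) → Set) → (List (Fin n) → ℕ) → ℕ → Set
MinOver P f s = (∃ λ ds → P ds × f ds ≡ s) × (∀ ds → P ds → s ≤ f ds)

AGeo : ∀ {k} → Vertex k → List (Fin k) → Set
AGeo u ds = IsGeodesic u (compl u) ds

AGeoCol : ∀ {k} → Coloring k → Vertex k → Bool → List (Fin k) → Set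
AGeoCol c u b ds = AGeo u ds × firstCol c u ds ≡ just b

-- t = min (s_{c,u,ū} , s'_{c,u,ū} - 1), in ℤ, where a minimum over an
-- empty set is +∞ (so if no geodesic starts red, or none starts blue,
-- then s' = ∞ and t = s).
GVal : ∀ {k} → Coloring k → Vertex k → ℤ → Set
GVal {k} c u t =
  Σ ℕ λ s → MinOver (AGeo u) (cc c u) s ×
    ( (Σ ℕ λ sr → Σ ℕ λ sb →
         MinOver (AGeoCol c u true) (cc c u) sr ×
         MinOver (AGeoCol c u false) (cc c u) sb ×
         t ≡ (+ s) ℤ.⊓ ((+ (sr Data.Nat.⊔ sb)) ℤ.- (+ 1)))
    ⊎ (((∀ ds → ¬ AGeoCol c u true ds) ⊎ (∀ ds → ¬ AGeoCol c u false ds))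
       × t ≡ + s) )

sumℤ : List ℤ → ℤ
sumℤ = L.foldr ℤ._+_ (+ 0)

-- F = 2^k · \hat f(k), i.e. F is the maximum over colourings c of Q_k
-- of Σ_u min(s_{c,u,ū}, s'_{c,u,ū} - 1).
IsFhatNum : (k : ℕ) → ℤ → Set
IsFhatNum k F =
  (Σ (Coloring k) λ c → Σ (Vertex k → ℤ) λ g →
     (∀ u → GVal c u (g u)) × sumℤ (map g (allVerts k)) ≡ F)
  × (∀ (c : Coloring k) (g : Vertex k → ℤ) →
       (∀ u → GVal c u (g u)) → sumℤ (map g (allVerts k)) ℤ.≤ F)

-- The procedure.  P = (u , ds) an antipodal geodesic of Q_n, with
-- vertices v_j = endV u (take j ds).  Q i is the replacement of the
-- chunk P_i (0 ≤ i < m).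

vtx : ∀ {n} → Vertex n → List (Fin n) → ℕ → Vertex n
vtx u ds j = endV u (take j ds)

ValidOutcome : ∀ {n} → Coloring n → (k m : ℕ) →
               Vertex n × List (Fin n) → (ℕ → List (Fin n)) → Set
ValidOutcome c k m (u , ds) Q =
  (∀ i → i < m →
     IsGeodesic (vtx u ds (k * i)) (vtx u ds (k * suc i)) (Q i) ×
     (∀ ds' → IsGeodesic (vtx u ds (k * i)) (vtx u ds (k * suc i)) ds' →
        cc c (vtx u ds (k * i)) (Q i) ≤ cc c (vtx u ds (k * i)) ds'))
  ×
  (∀ i → suc i < m →
     (∃ λ ds' →
        IsGeodesic (vtx u ds (k * suc i)) (vtx u ds (k * suc (suc i))) ds' ×
        (∀ ds'' → IsGeodesic (vtx u ds (k * suc i)) (vtx u ds (k * suc (suc i))) ds'' →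
           cc c (vtx u ds (k * suc i)) ds' ≤ cc c (vtx u ds (k * suc i)) ds'') ×
        firstCol c (vtx u ds (k * suc i)) ds' ≡ lastCol c (vtx u ds (k * i)) (Q i))
     → firstCol c (vtx u ds (k * suc i)) (Q (suc i)) ≡ lastCol c (vtx u ds (k * i)) (Q i))

resultDirs : ∀ {n} → (k m : ℕ) → List (Fin n) → (ℕ → List (Fin n)) → List (Fin n)
resultDirs k m ds Q = concat (map Q (upTo m)) ++ drop (k * m) ds

resultCC : ∀ {n} → Coloring n → (k m : ℕ) →
           Vertex n × List (Fin n) → (ℕ → List (Fin n)) → ℕ
resultCC c k m (u , ds) Q = cc c u (resultDirs k m ds Q)

{-# OPTIONS --safe #-}

-- The first m = ⌊n/k⌋ chunks of an antipodal geodesic P are antipodal geodesics of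
-- k-dimensional subcubes, and the procedure replaces each by a minimiser of colour changes
-- there. Charge chunk i with its own colour changes plus the change at its junction with
-- chunk i - 1. For the colouring restricted to the subcube and the local start vertex this
-- charge is at most min(s, s′ - 1) + 1: if s′ ≤ s then both colours start a minimiser, so
-- the tie-break makes the junction free. The unchanged final chunk adds at most n mod k.
-- Translating P by a vector supported on the directions of chunk i permutes the antipodal
-- geodesics, leaves the restricted colouring unchanged and runs the local start vertex over
-- all of Q_k; hence the average over P of min(s, s′ - 1) for chunk i is at most \hat f(k).
module Submission where

open import Defs
open import Data.Nat using (ℕ; _≤_; _^_; _+_; _*_; NonZero; _/_; _%_)
open import Data.Fin using (Fin)
open import Data.List using (List; length; map)
open import Data.Nat.ListAction using (sum)
open import Data.List.Membership.Propositional using (_∈_)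
open import Data.List.Relation.Unary.Unique.Propositional using (Unique)
open import Data.Product using (_×_)
open import Data.Integer as ℤ using (ℤ; +_)
open import Function.Bundles using (_⇔_)

import Algebra.Properties.CommutativeSemigroup as CommSemigroupₚ
open import Algebra.Bundles using (CommutativeMonoid)
open import Data.Bool using (Bool; true; false; not; _xor_; if_then_else_)
open import Data.Bool.Properties using (xor-assoc; xor-same; xor-identityʳ; not-distribˡ-xor; ¬-not)
  renaming (_≟_ to _≟B_)
open import Data.Empty using (⊥; ⊥-elim)
open import Data.Fin using (zero; suc; toℕ; fromℕ<)
import Data.Fin.Properties as Finₚ
import Data.Integer.Properties as ℤₚ
open import Data.Integer.Tactic.RingSolver using (solve-∀)
open import Data.List
  using ([]; _∷_; _++_; take; drop; allFin; tabulate; head; last; concat; upTo; filter; cartesianProductWith)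
open import Data.List.Extrema.Nat using (argmin; argmin-all; f[argmin]≤f[⊤]; f[argmin]≤f[xs])
open import Data.List.Membership.Propositional.Properties
  using (∉[]; ∈-allFin; ∈-cartesianProductWith⁺; ∈-filter⁺; ∈-++⁺ˡ; ∈-++⁺ʳ; ∈-map⁺; ∈-map⁻
        ; ∈-upTo⁻)
open import Data.List.Membership.Propositional.Properties.WithK using (unique∧set⇒bag)
import Data.List.Properties as Listₚ
open import Data.List.Relation.Binary.BagAndSetEquality using (∼bag⇒↭)
open import Data.List.Relation.Binary.Permutation.Propositional using (_↭_; ↭⇒↭ₛ)
import Data.List.Relation.Binary.Permutation.Propositional.Properties as Permₚ
open import Data.List.Relation.Binary.Permutation.Setoid.Properties using (foldr-commMonoid)
open import Data.List.Relation.Unary.All as All using (All; []; _∷_)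
open import Data.List.Relation.Unary.All.Properties using (all-filter)
open import Data.List.Relation.Unary.Any using (here; there)
open import Data.List.Relation.Unary.Unique.Propositional using ([]; _∷_)
import Data.List.Relation.Unary.Unique.Propositional.Properties as Uniqueₚ
open import Data.Maybe using (Maybe; just; nothing)
import Data.Maybe.Properties as Maybeₚ
open import Data.Nat using (zero; suc; _∸_; _<_; _⊓_; _⊔_; _≤?_; z≤n; s≤s; ≢-nonZero⁻¹; >-nonZero⁻¹)
open import Data.Nat.DivMod using (m/n*n≤m; m%n≡m∸m/n*n)
open import Data.Nat.ListAction.Properties using (sum-++)
open import Data.Nat.Properties
open CommSemigroupₚ +-commutativeSemigroup using (interchange)
open import Data.Product using (Σ; ∃; _,_; proj₁; proj₂; curry)
open import Data.Sum as Sum using (_⊎_; inj₁; inj₂)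
open import Data.Vec using (Vec; []; _∷_; lookup; replicate; zipWith; _[_]≔_)
import Data.Vec as Vec
import Data.Vec.Properties as Vecₚ
open import Function using (_∘_; Equivalence; mk⇔)
open import Function.Definitions using (Injective)
open import Relation.Binary.PropositionalEquality
open import Relation.Nullary using (¬_; does; yes; no)
open import Relation.Nullary.Decidable using (map′; _×-dec_)
open import Relation.Unary using (Decidable)

private
  variable
    n k : ℕ
    A B : Set

take-+ : ∀ p q (xs : List A) → take (p + q) xs ≡ take p xs ++ take q (drop p xs)
take-+ zero    q xs       = refl
take-+ (suc p) q []       = sym (Listₚ.take-[] q)
take-+ (suc p) q (x ∷ xs) = cong (x ∷_) (take-+ p q xs)

last-++-∷ : ∀ (xs : List A) y ys → last (xs ++ y ∷ ys) ≡ last (y ∷ ys)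
last-++-∷ []            y ys = refl
last-++-∷ (x ∷ [])      y ys = refl
last-++-∷ (x ∷ x′ ∷ xs) y ys = last-++-∷ (x′ ∷ xs) y ys

last-++ʳ : ∀ (xs : List A) {ys} → ys ≢ [] → last (xs ++ ys) ≡ last ys
last-++ʳ xs {[]}     ys≢[] = ⊥-elim (ys≢[] refl)
last-++ʳ xs {y ∷ ys} _     = last-++-∷ xs y ys

concat-upTo-suc : ∀ (W : ℕ → List A) m → concat (map W (upTo (suc m))) ≡ concat (map W (upTo m)) ++ W m
concat-upTo-suc W m = begin
  concat (map W (upTo (suc m)))             ≡⟨ cong (concat ∘ map W) (Listₚ.upTo-∷ʳ m) ⟨
  concat (map W (upTo m ++ m ∷ []))         ≡⟨ cong concat (Listₚ.map-++ W (upTo m) (m ∷ [])) ⟩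
  concat (map W (upTo m) ++ W m ∷ [])       ≡⟨ Listₚ.concat-++ (map W (upTo m)) (W m ∷ []) ⟨
  concat (map W (upTo m)) ++ (W m ++ [])    ≡⟨ cong (concat (map W (upTo m)) ++_) (Listₚ.++-identityʳ (W m)) ⟩
  concat (map W (upTo m)) ++ W m            ∎
  where open ≡-Reasoning

sum-upTo-suc : ∀ (f : ℕ → ℕ) m → sum (map f (upTo (suc m))) ≡ sum (map f (upTo m)) + f m
sum-upTo-suc f m = begin
  sum (map f (upTo (suc m)))          ≡⟨ cong (sum ∘ map f) (Listₚ.upTo-∷ʳ m) ⟨
  sum (map f (upTo m ++ m ∷ []))      ≡⟨ cong sum (Listₚ.map-++ f (upTo m) (m ∷ [])) ⟩
  sum (map f (upTo m) ++ f m ∷ [])    ≡⟨ sum-++ (map f (upTo m)) (f m ∷ []) ⟩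
  sum (map f (upTo m)) + (f m + 0)    ≡⟨ cong (_+_ (sum (map f (upTo m)))) (+-identityʳ (f m)) ⟩
  sum (map f (upTo m)) + f m          ∎
  where open ≡-Reasoning

nthOr : A → List A → ℕ → A
nthOr d []       _       = d
nthOr d (x ∷ xs) zero    = x
nthOr d (x ∷ xs) (suc i) = nthOr d xs i

nthOr-∈ : ∀ (d : A) xs {i} → i < length xs → nthOr d xs i ∈ xs
nthOr-∈ d (x ∷ xs) {zero}  _         = here refl
nthOr-∈ d (x ∷ xs) {suc i} (s≤s i<) = there (nthOr-∈ d xs i<)

nthOr-injective : ∀ (d : A) {xs} → Unique xs → ∀ {i j} → i < length xs → j < length xs →
                  nthOr d xs i ≡ nthOr d xs j → i ≡ j
nthOr-injective d {x ∷ xs} _               {zero}  {zero}  _         _         _  = refl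
nthOr-injective d {x ∷ xs} (x∉xs ∷ _)      {zero}  {suc j} _         (s≤s j<) eq =
  ⊥-elim (All.lookup x∉xs (nthOr-∈ d xs j<) eq)
nthOr-injective d {x ∷ xs} (x∉xs ∷ _)      {suc i} {zero}  (s≤s i<) _         eq =
  ⊥-elim (All.lookup x∉xs (nthOr-∈ d xs i<) (sym eq))
nthOr-injective d {x ∷ xs} (_ ∷ xs-unique) {suc i} {suc j} (s≤s i<) (s≤s j<) eq =
  cong suc (nthOr-injective d xs-unique i< j< eq)

tabulate-nthOr : ∀ (d : A) xs {k} → length xs ≡ k → tabulate {n = k} (nthOr d xs ∘ toℕ) ≡ xs
tabulate-nthOr d []       refl = refl
tabulate-nthOr d (x ∷ xs) refl = cong (x ∷_) (tabulate-nthOr d xs refl)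

vec-ext : ∀ (xs ys : Vec A n) → (∀ i → lookup xs i ≡ lookup ys i) → xs ≡ ys
vec-ext xs ys eq = trans (sym (Vecₚ.tabulate∘lookup xs)) (trans (Vecₚ.tabulate-cong eq) (Vecₚ.tabulate∘lookup ys))

infixl 6 _⊕_

_⊕_ : Vertex n → Vertex n → Vertex n
_⊕_ = zipWith _xor_

⊕-involutive : ∀ (u z : Vertex n) → (u ⊕ z) ⊕ z ≡ u
⊕-involutive []      []      = refl
⊕-involutive (x ∷ u) (y ∷ z) =
  cong₂ _∷_ (trans (xor-assoc x y y) (trans (cong (x xor_) (xor-same y)) (xor-identityʳ x)))
            (⊕-involutive u z)

⊕-cancelˡ : ∀ (u z : Vertex n) → u ⊕ (u ⊕ z) ≡ z
⊕-cancelˡ []      []      = refl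
⊕-cancelˡ (x ∷ u) (y ∷ z) =
  cong₂ _∷_ (trans (sym (xor-assoc x x y)) (cong (_xor y) (xor-same x))) (⊕-cancelˡ u z)

compl-⊕ : ∀ (u z : Vertex n) → compl (u ⊕ z) ≡ compl u ⊕ z
compl-⊕ []      []      = refl
compl-⊕ (x ∷ u) (y ∷ z) = cong₂ _∷_ (not-distribˡ-xor x y) (compl-⊕ u z)

flipV-⊕ : ∀ (u z : Vertex n) i → flipV (u ⊕ z) i ≡ flipV u i ⊕ z
flipV-⊕ (x ∷ u) (y ∷ z) zero    = cong (_∷ (u ⊕ z)) (not-distribˡ-xor x y)
flipV-⊕ (x ∷ u) (y ∷ z) (suc i) = cong ((x xor y) ∷_) (flipV-⊕ u z i)

endV-⊕ : ∀ (u z : Vertex n) ds → endV (u ⊕ z) ds ≡ endV u ds ⊕ z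
endV-⊕ u z []       = refl
endV-⊕ u z (i ∷ ds) = trans (cong (λ v → endV v ds) (flipV-⊕ u z i)) (endV-⊕ (flipV u i) z ds)

endV-++ : ∀ (u : Vertex n) xs ys → endV u (xs ++ ys) ≡ endV (endV u xs) ys
endV-++ u []       ys = refl
endV-++ u (i ∷ xs) ys = endV-++ (flipV u i) xs ys

endV-map-suc : ∀ x (u : Vertex n) ds → endV (x ∷ u) (map suc ds) ≡ x ∷ endV u ds
endV-map-suc x u []       = refl
endV-map-suc x u (i ∷ ds) = endV-map-suc x (flipV u i) ds

endV-allFin : ∀ (u : Vertex n) → endV u (allFin n) ≡ compl u
endV-allFin []      = refl
endV-allFin (x ∷ u) = begin
  endV (not x ∷ u) (tabulate suc)         ≡⟨ cong (endV (not x ∷ u)) (Listₚ.map-tabulate (λ i → i) suc) ⟨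
  endV (not x ∷ u) (map suc (allFin _))   ≡⟨ endV-map-suc (not x) u (allFin _) ⟩
  not x ∷ endV u (allFin _)               ≡⟨ cong (not x ∷_) (endV-allFin u) ⟩
  not x ∷ compl u                         ∎
  where open ≡-Reasoning

-- Hamming distance and geodesics

differ : Bool → Bool → ℕ
differ x y = if x xor y then 1 else 0

dist : Vertex n → Vertex n → ℕ
dist []      []      = 0
dist (x ∷ u) (y ∷ w) = differ x y + dist u w

dist-refl : ∀ (u : Vertex n) → dist u u ≡ 0
dist-refl []          = refl
dist-refl (true ∷ u)  = dist-refl u
dist-refl (false ∷ u) = dist-refl u

dist-compl : ∀ (u : Vertex n) → dist u (compl u) ≡ n
dist-compl []          = refl
dist-compl (true ∷ u)  = cong suc (dist-compl u)
dist-compl (false ∷ u) = cong suc (dist-compl u)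

differ-triangle : ∀ x y z → differ x z ≤ differ x y + differ y z
differ-triangle true  true  z     = ≤-refl
differ-triangle false false z     = ≤-refl
differ-triangle true  false true  = z≤n
differ-triangle true  false false = ≤-refl
differ-triangle false true  true  = ≤-refl
differ-triangle false true  false = z≤n

dist-triangle : ∀ (u v w : Vertex n) → dist u w ≤ dist u v + dist v w
dist-triangle []      []      []      = z≤n
dist-triangle (x ∷ u) (y ∷ v) (z ∷ w) = begin
  differ x z + dist u w                              ≤⟨ +-mono-≤ (differ-triangle x y z) (dist-triangle u v w) ⟩
  (differ x y + differ y z) + (dist u v + dist v w)  ≡⟨ interchange (differ x y) _ _ _ ⟩
  (differ x y + dist u v) + (differ y z + dist v w)  ∎
  where open ≤-Reasoning

dist-flipV : ∀ (u w : Vertex n) i → dist u w ≤ suc (dist (flipV u i) w)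
dist-flipV (x ∷ u) (y ∷ w) zero    = +-monoˡ-≤ (dist u w) (differ-flip x y)
  where
  differ-flip : ∀ x y → differ x y ≤ suc (differ (not x) y)
  differ-flip true  true  = z≤n
  differ-flip true  false = s≤s z≤n
  differ-flip false true  = s≤s z≤n
  differ-flip false false = z≤n
dist-flipV (x ∷ u) (y ∷ w) (suc i) =
  ≤-trans (+-monoʳ-≤ (differ x y) (dist-flipV u w i)) (≤-reflexive (+-suc (differ x y) _))

dist-flipV-agree : ∀ (u w : Vertex n) i → lookup u i ≡ lookup w i → dist (flipV u i) w ≡ suc (dist u w)
dist-flipV-agree (true  ∷ u) (.true  ∷ w) zero refl = refl
dist-flipV-agree (false ∷ u) (.false ∷ w) zero refl = refl
dist-flipV-agree (x ∷ u) (y ∷ w) (suc i) eq =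
  trans (cong (_+_ (differ x y)) (dist-flipV-agree u w i eq)) (+-suc (differ x y) _)

dist≤length : ∀ (u : Vertex n) ds → dist u (endV u ds) ≤ length ds
dist≤length u []       = ≤-reflexive (dist-refl u)
dist≤length u (i ∷ ds) = ≤-trans (dist-flipV u _ i) (s≤s (dist≤length (flipV u i) ds))

shortestWalk : ∀ (u w : Vertex n) → ∃ λ ds → endV u ds ≡ w × length ds ≡ dist u w
shortestWalk []      []      = [] , refl , refl
shortestWalk (x ∷ u) (y ∷ w) with shortestWalk u w
... | ds , end , len = extend x y
  where
  stay : ∀ x → endV (x ∷ u) (map suc ds) ≡ x ∷ w
  stay x = trans (endV-map-suc x u ds) (cong (x ∷_) end)
  stay-length : length (map suc ds) ≡ dist u w
  stay-length = trans (Listₚ.length-map suc ds) len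
  extend : ∀ x y → ∃ λ ds → endV (x ∷ u) ds ≡ y ∷ w × length ds ≡ differ x y + dist u w
  extend true  true  = map suc ds , stay true , stay-length
  extend false false = map suc ds , stay false , stay-length
  extend true  false = zero ∷ map suc ds , stay false , cong suc stay-length
  extend false true  = zero ∷ map suc ds , stay true , cong suc stay-length

IsGeodesic⇒length≡dist : ∀ {u w : Vertex n} ds → IsGeodesic u w ds → length ds ≡ dist u w
IsGeodesic⇒length≡dist {u = u} ds (refl , shortest) =
  let ds′ , end′ , length′ = shortestWalk u (endV u ds) in
  ≤-antisym (≤-trans (shortest ds′ end′) (≤-reflexive length′)) (dist≤length u ds)

length≡dist⇒IsGeodesic : ∀ {u w : Vertex n} ds → endV u ds ≡ w → length ds ≡ dist u w → IsGeodesic u w ds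
length≡dist⇒IsGeodesic {u = u} ds end len =
  end , λ ds′ end′ →
    ≤-trans (≤-reflexive len) (subst (λ v → dist u v ≤ length ds′) end′ (dist≤length u ds′))

geodesic-++⁻ : ∀ {u w : Vertex n} xs ys → IsGeodesic u w (xs ++ ys) →
               IsGeodesic u (endV u xs) xs × IsGeodesic (endV u xs) w ys
geodesic-++⁻ {n = n} {u = u} {w} xs ys geo =
  length≡dist⇒IsGeodesic xs refl (≤-antisym xs-long xs-short) ,
  length≡dist⇒IsGeodesic ys ys-end (≤-antisym ys-long ys-short)
  where
  v : Vertex n
  v = endV u xs
  ys-end : endV v ys ≡ w
  ys-end = trans (sym (endV-++ u xs ys)) (proj₁ geo)
  xs-short : dist u v ≤ length xs
  xs-short = dist≤length u xs
  ys-short : dist v w ≤ length ys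
  ys-short = subst (λ z → dist v z ≤ length ys) ys-end (dist≤length v ys)
  tight : length xs + length ys ≤ dist u v + dist v w
  tight = ≤-trans (≤-reflexive (trans (sym (Listₚ.length-++ xs)) (IsGeodesic⇒length≡dist (xs ++ ys) geo)))
                  (dist-triangle u v w)
  xs-long : length xs ≤ dist u v
  xs-long = +-cancelʳ-≤ (length ys) (length xs) (dist u v) (≤-trans tight (+-monoʳ-≤ (dist u v) ys-short))
  ys-long : length ys ≤ dist v w
  ys-long = +-cancelˡ-≤ (length xs) (length ys) (dist v w) (≤-trans tight (+-monoˡ-≤ (dist v w) xs-short))

geodesic-directions : ∀ {u w : Vertex n} ds → IsGeodesic u w ds →
                      Unique ds × All (λ i → lookup u i ≢ lookup w i) ds
geodesic-directions []       _   = [] , []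
geodesic-directions {u = u} {w} (i ∷ ds) geo =
  (All.tabulate i∉ds ∷ proj₁ rest) , (i-differs ∷ All.tabulate rest-differs)
  where
  tail-geo : IsGeodesic (flipV u i) w ds
  tail-geo = proj₂ (geodesic-++⁻ (i ∷ []) ds geo)
  rest : Unique ds × All (λ j → lookup (flipV u i) j ≢ lookup w j) ds
  rest = geodesic-directions ds tail-geo
  i-differs : lookup u i ≢ lookup w i
  i-differs agree = 1+n≰n (≤-trans (n≤1+n _) (≤-reflexive (begin
    suc (suc (length ds))          ≡⟨ cong suc (IsGeodesic⇒length≡dist (i ∷ ds) geo) ⟩
    suc (dist u w)                 ≡⟨ dist-flipV-agree u w i agree ⟨
    dist (flipV u i) w             ≡⟨ IsGeodesic⇒length≡dist ds tail-geo ⟨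
    length ds                      ∎)))
    where open ≡-Reasoning
  i∉ds : ∀ {j} → j ∈ ds → i ≢ j
  i∉ds j∈ds refl = All.lookup (proj₂ rest) j∈ds
    (trans (Vecₚ.lookup∘update i u _) (sym (¬-not (i-differs ∘ sym))))
  rest-differs : ∀ {j} → j ∈ ds → lookup u j ≢ lookup w j
  rest-differs j∈ds agree = All.lookup (proj₂ rest) j∈ds
    (trans (Vecₚ.lookup∘update′ (i∉ds j∈ds ∘ sym) u _) agree)

geodesic-⊕ : ∀ {u w : Vertex n} {ds} z → IsGeodesic u w ds → IsGeodesic (u ⊕ z) (w ⊕ z) ds
geodesic-⊕ {u = u} {w} {ds} z (end , shortest) =
  trans (endV-⊕ u z ds) (cong (_⊕ z) end) ,
  λ ds′ end′ → shortest ds′ (begin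
    endV u ds′                 ≡⟨ ⊕-involutive (endV u ds′) z ⟨
    endV u ds′ ⊕ z ⊕ z         ≡⟨ cong (_⊕ z) (endV-⊕ u z ds′) ⟨
    endV (u ⊕ z) ds′ ⊕ z       ≡⟨ cong (_⊕ z) end′ ⟩
    w ⊕ z ⊕ z                  ≡⟨ ⊕-involutive w z ⟩
    w                          ∎)
  where open ≡-Reasoning

infix-geodesic : ∀ {u w : Vertex n} {ds} → IsGeodesic u w ds → ∀ p q →
                 IsGeodesic (endV u (take p ds)) (endV u (take (p + q) ds)) (take q (drop p ds))
infix-geodesic {u = u} {ds = ds} geo p q =
  proj₂ (geodesic-++⁻ (take p ds) (take q (drop p ds))
    (subst (IsGeodesic u (endV u (take (p + q) ds))) (take-+ p q ds) prefix-geo))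
  where
  prefix-geo : IsGeodesic u (endV u (take (p + q) ds)) (take (p + q) ds)
  prefix-geo = proj₁ (geodesic-++⁻ (take (p + q) ds) (drop (p + q) ds)
    (subst (IsGeodesic u _) (sym (Listₚ.take++drop≡id (p + q) ds)) geo))

-- Colour changes along concatenated walks

changeBetween : Maybe Bool → Maybe Bool → ℕ
changeBetween (just a) (just b) = if does (a ≟B b) then 0 else 1
changeBetween _        _        = 0

changeBetween≤1 : ∀ p q → changeBetween p q ≤ 1
changeBetween≤1 (just true)  (just true)  = z≤n
changeBetween≤1 (just true)  (just false) = ≤-refl
changeBetween≤1 (just false) (just true)  = ≤-refl
changeBetween≤1 (just false) (just false) = z≤n
changeBetween≤1 (just _)     nothing      = z≤n
changeBetween≤1 nothing      _            = z≤n

changes-∷ : ∀ x ys → changes (x ∷ ys) ≡ changeBetween (just x) (head ys) + changes ys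
changes-∷ x []      = refl
changes-∷ x (y ∷ ys) = refl

changes-∷≤length : ∀ x ys → changes (x ∷ ys) ≤ length ys
changes-∷≤length x []       = z≤n
changes-∷≤length x (y ∷ ys) = +-mono-≤ (changeBetween≤1 (just x) (just y)) (changes-∷≤length y ys)

changes-++ : ∀ xs ys → changes (xs ++ ys) ≤ changes xs + changeBetween (last xs) (head ys) + changes ys
changes-++ []             ys = ≤-refl
changes-++ (x ∷ [])       ys = ≤-reflexive (changes-∷ x ys)
changes-++ (x ∷ x′ ∷ xs) ys = begin
  changes (x ∷ x′ ∷ xs ++ ys)
    ≤⟨ +-monoʳ-≤ δ (changes-++ (x′ ∷ xs) ys) ⟩
  δ + (changes (x′ ∷ xs) + changeBetween (last (x′ ∷ xs)) (head ys) + changes ys)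
    ≡⟨ cong (_+_ δ) (+-assoc (changes (x′ ∷ xs)) _ _) ⟩
  δ + (changes (x′ ∷ xs) + (changeBetween (last (x′ ∷ xs)) (head ys) + changes ys))
    ≡⟨ +-assoc δ _ _ ⟨
  changes (x ∷ x′ ∷ xs) + (changeBetween (last (x′ ∷ xs)) (head ys) + changes ys)
    ≡⟨ +-assoc (changes (x ∷ x′ ∷ xs)) _ _ ⟨
  changes (x ∷ x′ ∷ xs) + changeBetween (last (x′ ∷ xs)) (head ys) + changes ys ∎
  where
  open ≤-Reasoning
  δ : ℕ
  δ = changeBetween (just x) (just x′)

changes-++≤ : ∀ xs ys → changes (xs ++ ys) ≤ changes xs + length ys
changes-++≤ xs []       = ≤-reflexive (trans (cong changes (Listₚ.++-identityʳ xs)) (sym (+-identityʳ _)))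
changes-++≤ xs (y ∷ ys) = begin
  changes (xs ++ y ∷ ys)
    ≤⟨ changes-++ xs (y ∷ ys) ⟩
  changes xs + changeBetween (last xs) (just y) + changes (y ∷ ys)
    ≡⟨ +-assoc (changes xs) _ _ ⟩
  changes xs + (changeBetween (last xs) (just y) + changes (y ∷ ys))
    ≤⟨ +-monoʳ-≤ (changes xs) (+-mono-≤ (changeBetween≤1 (last xs) _) (changes-∷≤length y ys)) ⟩
  changes xs + suc (length ys) ∎
  where open ≤-Reasoning

colors-++ : ∀ (c : Coloring n) (u : Vertex n) xs ys →
            colors c u (xs ++ ys) ≡ colors c u xs ++ colors c (endV u xs) ys
colors-++ c u []       ys = refl
colors-++ c u (i ∷ xs) ys = cong (edgeCol c u i ∷_) (colors-++ c (flipV u i) xs ys)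

length-colors : ∀ (c : Coloring n) (u : Vertex n) ds → length (colors c u ds) ≡ length ds
length-colors c u []       = refl
length-colors c u (i ∷ ds) = cong suc (length-colors c (flipV u i) ds)

colors≢[] : ∀ (c : Coloring n) u {ds} → ds ≢ [] → colors c u ds ≢ []
colors≢[] c u {[]}     ds≢[] _  = ds≢[] refl
colors≢[] c u {i ∷ ds} _     ()

module SegmentedWalk (c : Coloring n) (V : ℕ → Vertex n) (W : ℕ → List (Fin n)) where

  colourBefore : ℕ → Maybe Bool
  colourBefore zero    = nothing
  colourBefore (suc i) = lastCol c (V i) (W i)

  segmentCost : ℕ → ℕ
  segmentCost i = changeBetween (colourBefore i) (firstCol c (V i) (W i)) + cc c (V i) (W i)

  Linked : ℕ → Set
  Linked m = ∀ i → i < m → endV (V i) (W i) ≡ V (suc i) × W i ≢ []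

  firstSegments : ℕ → List (Fin n)
  firstSegments m = concat (map W (upTo m))

  private
    linked-pred : ∀ {m} → Linked (suc m) → Linked m
    linked-pred linked i i<m = linked i (m<n⇒m<1+n i<m)

  endV-concat : ∀ m → Linked m → endV (V 0) (firstSegments m) ≡ V m
  endV-concat zero    _      = refl
  endV-concat (suc m) linked = begin
    endV (V 0) (firstSegments (suc m))          ≡⟨ cong (endV (V 0)) (concat-upTo-suc W m) ⟩
    endV (V 0) (firstSegments m ++ W m)         ≡⟨ endV-++ (V 0) (firstSegments m) (W m) ⟩
    endV (endV (V 0) (firstSegments m)) (W m)   ≡⟨ cong (λ v → endV v (W m)) (endV-concat m (linked-pred linked)) ⟩
    endV (V m) (W m)                     ≡⟨ proj₁ (linked m ≤-refl) ⟩
    V (suc m)                            ∎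
    where open ≡-Reasoning

  colors-concat-suc : ∀ m → Linked (suc m) →
                      colors c (V 0) (firstSegments (suc m)) ≡ colors c (V 0) (firstSegments m) ++ colors c (V m) (W m)
  colors-concat-suc m linked = begin
    colors c (V 0) (firstSegments (suc m))
      ≡⟨ cong (colors c (V 0)) (concat-upTo-suc W m) ⟩
    colors c (V 0) (firstSegments m ++ W m)
      ≡⟨ colors-++ c (V 0) (firstSegments m) (W m) ⟩
    colors c (V 0) (firstSegments m) ++ colors c (endV (V 0) (firstSegments m)) (W m)
      ≡⟨ cong (λ v → colors c (V 0) (firstSegments m) ++ colors c v (W m)) (endV-concat m (linked-pred linked)) ⟩
    colors c (V 0) (firstSegments m) ++ colors c (V m) (W m) ∎
    where open ≡-Reasoning

  cc-concat : ∀ m → Linked m →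
              lastCol c (V 0) (firstSegments m) ≡ colourBefore m ×
              cc c (V 0) (firstSegments m) ≤ sum (map segmentCost (upTo m))
  cc-concat zero    _      = refl , z≤n
  cc-concat (suc m) linked =
    trans (cong last colors-eq) (last-++ʳ X (colors≢[] c (V m) (proj₂ (linked m ≤-refl)))) ,
    (begin
      changes (colors c (V 0) (firstSegments (suc m)))
        ≡⟨ cong changes colors-eq ⟩
      changes (X ++ Y)
        ≤⟨ changes-++ X Y ⟩
      changes X + changeBetween (last X) (head Y) + changes Y
        ≡⟨ cong (λ p → changes X + changeBetween p (head Y) + changes Y) last-X ⟩
      changes X + changeBetween (colourBefore m) (head Y) + changes Y
        ≡⟨ +-assoc (changes X) _ _ ⟩
      changes X + segmentCost m
        ≤⟨ +-monoˡ-≤ (segmentCost m) bound-X ⟩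
      sum (map segmentCost (upTo m)) + segmentCost m
        ≡⟨ sum-upTo-suc segmentCost m ⟨
      sum (map segmentCost (upTo (suc m))) ∎)
    where
    open ≤-Reasoning
    X Y : List Bool
    X = colors c (V 0) (firstSegments m)
    Y = colors c (V m) (W m)
    colors-eq : colors c (V 0) (firstSegments (suc m)) ≡ X ++ Y
    colors-eq = colors-concat-suc m linked
    last-X : last X ≡ colourBefore m
    last-X = proj₁ (cc-concat m (linked-pred linked))
    bound-X : changes X ≤ sum (map segmentCost (upTo m))
    bound-X = proj₂ (cc-concat m (linked-pred linked))

  cc-concat-++ : ∀ m tail → Linked m →
                 cc c (V 0) (firstSegments m ++ tail) ≤ sum (map segmentCost (upTo m)) + length tail
  cc-concat-++ m tail linked = begin
    changes (colors c (V 0) (firstSegments m ++ tail))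
      ≡⟨ cong changes (colors-++ c (V 0) (firstSegments m) tail) ⟩
    changes (colors c (V 0) (firstSegments m) ++ colors c (endV (V 0) (firstSegments m)) tail)
      ≤⟨ changes-++≤ (colors c (V 0) (firstSegments m)) _ ⟩
    cc c (V 0) (firstSegments m) + length (colors c (endV (V 0) (firstSegments m)) tail)
      ≡⟨ cong (_+_ (cc c (V 0) (firstSegments m))) (length-colors c _ tail) ⟩
    cc c (V 0) (firstSegments m) + length tail
      ≤⟨ +-monoˡ-≤ (length tail) (proj₂ (cc-concat m linked)) ⟩
    sum (map segmentCost (upTo m)) + length tail ∎
    where open ≤-Reasoning

walksOfLength : ∀ k → ℕ → List (List (Fin k))
walksOfLength k zero    = [] ∷ []
walksOfLength k (suc l) = cartesianProductWith _∷_ (allFin k) (walksOfLength k l)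

∈-walksOfLength : ∀ {k} (ds : List (Fin k)) → ds ∈ walksOfLength k (length ds)
∈-walksOfLength []       = here refl
∈-walksOfLength (i ∷ ds) = ∈-cartesianProductWith⁺ _∷_ (∈-allFin i) (∈-walksOfLength ds)

minimum-or-empty : ∀ {P : List (Fin n) → Set} → Decidable P → (f : List (Fin n) → ℕ) →
                   (L : List (List (Fin n))) → (∀ ds → P ds → ds ∈ L) →
                   Σ ℕ (MinOver P f) ⊎ (∀ ds → ¬ P ds)
minimum-or-empty {P = P} P? f L complete =
  argmin-of (filter P? L) (all-filter P? L) (λ ds p → ∈-filter⁺ P? (complete ds p) p)
  where
  argmin-of : ∀ xs → All P xs → (∀ ds → P ds → ds ∈ xs) → Σ ℕ (MinOver P f) ⊎ (∀ ds → ¬ P ds)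
  argmin-of []       _          complete′ = inj₂ λ ds p → ∉[] (complete′ ds p)
  argmin-of (x ∷ xs) (px ∷ pxs) complete′ =
    inj₁ (f (argmin f x xs) , (argmin f x xs , argmin-all f px pxs , refl) , minimal)
    where
    minimal : ∀ ds → P ds → f (argmin f x xs) ≤ f ds
    minimal ds p with complete′ ds p
    ... | here refl   = f[argmin]≤f[⊤] {f = f} x xs
    ... | there ds∈xs = All.lookup (f[argmin]≤f[xs] {f = f} x xs) ds∈xs

AGeo⇒ : ∀ {k} {w : Vertex k} ds → AGeo w ds → endV w ds ≡ compl w × length ds ≡ k
AGeo⇒ {w = w} ds geo = proj₁ geo , trans (IsGeodesic⇒length≡dist ds geo) (dist-compl w)

AGeo⇐ : ∀ {k} {w : Vertex k} ds → endV w ds ≡ compl w → length ds ≡ k → AGeo w ds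
AGeo⇐ {w = w} ds end len = length≡dist⇒IsGeodesic ds end (trans len (sym (dist-compl w)))

AGeo? : ∀ {k} (w : Vertex k) → Decidable (AGeo w)
AGeo? {k} w ds = map′ (λ (end , len) → AGeo⇐ ds end len) (AGeo⇒ ds)
                      (Vecₚ.≡-dec _≟B_ (endV w ds) (compl w) ×-dec (length ds ≟ k))

AGeoCol? : ∀ {k} (c : Coloring k) (w : Vertex k) b → Decidable (AGeoCol c w b)
AGeoCol? c w b ds = AGeo? w ds ×-dec Maybeₚ.≡-dec _≟B_ (firstCol c w ds) (just b)

minimum-over-antipodal : ∀ {k} (c : Coloring k) (w : Vertex k) {P : List (Fin k) → Set} →
                         Decidable P → (∀ {ds} → P ds → AGeo w ds) →
                         Σ ℕ (MinOver P (cc c w)) ⊎ (∀ ds → ¬ P ds)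
minimum-over-antipodal {k} c w P? antipodal = minimum-or-empty P? (cc c w) (walksOfLength k k)
  λ ds p → subst (λ l → ds ∈ walksOfLength k l) (proj₂ (AGeo⇒ ds (antipodal p))) (∈-walksOfLength ds)

antipodalGeodesic : ∀ {k} (w : Vertex k) → ∃ λ ds → AGeo w ds
antipodalGeodesic w with shortestWalk w (compl w)
... | ds , end , len = ds , AGeo⇐ ds end (trans len (dist-compl w))

gval : ∀ {k} (c : Coloring k) (w : Vertex k) → Σ ℤ (GVal c w)
gval c w with minimum-over-antipodal c w (AGeo? w) (λ geo → geo)
            | minimum-over-antipodal c w (AGeoCol? c w true) proj₁
            | minimum-over-antipodal c w (AGeoCol? c w false) proj₁
... | inj₂ none | _ | _ = let ds , geo = antipodalGeodesic w in ⊥-elim (none ds geo)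
... | inj₁ (s , s-min) | inj₁ (sr , r-min) | inj₁ (sb , b-min) =
  _ , s , s-min , inj₁ (sr , sb , r-min , b-min , refl)
... | inj₁ (s , s-min) | inj₂ no-red | _ =
  _ , s , s-min , inj₂ (inj₁ no-red , refl)
... | inj₁ (s , s-min) | inj₁ _ | inj₂ no-blue =
  _ , s , s-min , inj₂ (inj₂ no-blue , refl)

MinOver-resp : ∀ {P P′ : List (Fin n) → Set} {f f′ : List (Fin n) → ℕ} {s} →
               (∀ {ds} → P ds → P′ ds) → (∀ {ds} → P′ ds → P ds) → (∀ ds → f ds ≡ f′ ds) →
               MinOver P f s → MinOver P′ f′ s
MinOver-resp to from f≡f′ ((ds , p , fds≡s) , minimal) =
  (ds , to p , trans (sym (f≡f′ ds)) fds≡s) ,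
  λ ds′ p′ → subst (_ ≤_) (f≡f′ ds′) (minimal ds′ (from p′))

colors-cong : ∀ {c₁ c₂ : Coloring n} → (∀ v j → c₁ v j ≡ c₂ v j) →
              ∀ u ds → colors c₁ u ds ≡ colors c₂ u ds
colors-cong c₁≗c₂ u []       = refl
colors-cong c₁≗c₂ u (i ∷ ds) = cong₂ _∷_ (c₁≗c₂ _ i) (colors-cong c₁≗c₂ (flipV u i) ds)

module _ {c₁ c₂ : Coloring k} (c₁≗c₂ : ∀ v j → c₁ v j ≡ c₂ v j) {w : Vertex k} where

  private
    cc-eq : ∀ ds → cc c₁ w ds ≡ cc c₂ w ds
    cc-eq ds = cong changes (colors-cong c₁≗c₂ w ds)

    firstCol-eq : ∀ ds → firstCol c₁ w ds ≡ firstCol c₂ w ds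
    firstCol-eq ds = cong head (colors-cong c₁≗c₂ w ds)

    to : ∀ {b ds} → AGeoCol c₁ w b ds → AGeoCol c₂ w b ds
    to {ds = ds} (geo , first) = geo , trans (sym (firstCol-eq ds)) first

    from : ∀ {b ds} → AGeoCol c₂ w b ds → AGeoCol c₁ w b ds
    from {ds = ds} (geo , first) = geo , trans (firstCol-eq ds) first

  GVal-cong : ∀ {t} → GVal c₁ w t → GVal c₂ w t
  GVal-cong (s , s-min , inj₁ (sr , sb , r-min , b-min , t≡)) =
    s , MinOver-resp (λ geo → geo) (λ geo → geo) cc-eq s-min ,
    inj₁ (sr , sb , MinOver-resp to from cc-eq r-min , MinOver-resp to from cc-eq b-min , t≡)
  GVal-cong (s , s-min , inj₂ (colour-missing , t≡)) =
    s , MinOver-resp (λ geo → geo) (λ geo → geo) cc-eq s-min ,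
    inj₂ (Sum.map (λ none ds → none ds ∘ from) (λ none ds → none ds ∘ from) colour-missing , t≡)

-- Subcubes

-- embed a σ w is the vertex of the subcube through a spanned by the directions σ whose
-- local coordinates are w.
embed : Vertex n → (Fin k → Fin n) → Vertex k → Vertex n
embed a σ []      = a
embed a σ (x ∷ w) = embed a (σ ∘ suc) w [ σ zero ]≔ x

localCoords : (Fin k → Fin n) → Vertex n → Vertex k
localCoords σ a = Vec.tabulate (lookup a ∘ σ)

restrict : Coloring n → (Fin k → Fin n) → Vertex n → Coloring k
restrict c σ a w j = c (embed a σ w) (σ j)

lookup-embed-∉ : ∀ (a : Vertex n) (σ : Fin k → Fin n) w {y} → (∀ j → σ j ≢ y) →
                 lookup (embed a σ w) y ≡ lookup a y
lookup-embed-∉ a σ []      y∉σ = refl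
lookup-embed-∉ a σ (x ∷ w) y∉σ =
  trans (Vecₚ.lookup∘update′ (y∉σ zero ∘ sym) (embed a (σ ∘ suc) w) x)
        (lookup-embed-∉ a (σ ∘ suc) w (y∉σ ∘ suc))

lookup-embed : ∀ (a : Vertex n) {σ : Fin k → Fin n} → Injective _≡_ _≡_ σ →
               ∀ w j → lookup (embed a σ w) (σ j) ≡ lookup w j
lookup-embed a {σ} σ-inj (x ∷ w) zero    = Vecₚ.lookup∘update (σ zero) (embed a (σ ∘ suc) w) x
lookup-embed a {σ} σ-inj (x ∷ w) (suc j) =
  trans (Vecₚ.lookup∘update′ (Finₚ.0≢1+n ∘ σ-inj ∘ sym) (embed a (σ ∘ suc) w) x)
        (lookup-embed a (Finₚ.suc-injective ∘ σ-inj) w j)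

embed-localCoords : ∀ (a : Vertex n) (σ : Fin k → Fin n) → embed a σ (localCoords σ a) ≡ a
embed-localCoords {k = zero}  a σ = refl
embed-localCoords {k = suc k} a σ =
  trans (cong (_[ σ zero ]≔ lookup a (σ zero)) (embed-localCoords a (σ ∘ suc))) (Vecₚ.[]≔-lookup a (σ zero))

embed-update : ∀ (a : Vertex n) {σ : Fin k → Fin n} → Injective _≡_ _≡_ σ → ∀ w j x →
               embed a σ (w [ j ]≔ x) ≡ embed a σ w [ σ j ]≔ x
embed-update a {σ} σ-inj (y ∷ w) zero    x = sym (Vecₚ.[]≔-idempotent (embed a (σ ∘ suc) w) (σ zero))
embed-update a {σ} σ-inj (y ∷ w) (suc j) x =
  trans (cong (_[ σ zero ]≔ y) (embed-update a (Finₚ.suc-injective ∘ σ-inj) w j x))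
        (Vecₚ.[]≔-commutes (embed a (σ ∘ suc) w) (σ (suc j)) (σ zero) (Finₚ.0≢1+n ∘ σ-inj ∘ sym))

embed-injective : ∀ (a : Vertex n) {σ : Fin k → Fin n} → Injective _≡_ _≡_ σ →
                  Injective _≡_ _≡_ (embed a σ)
embed-injective a {σ} σ-inj {w₁} {w₂} eq =
  vec-ext w₁ w₂ λ j →
    trans (sym (lookup-embed a σ-inj w₁ j)) (trans (cong (λ v → lookup v (σ j)) eq) (lookup-embed a σ-inj w₂ j))

embed-cong : ∀ {a a′ : Vertex n} {σ : Fin k → Fin n} → Injective _≡_ _≡_ σ →
             (∀ y → (∀ j → σ j ≢ y) → lookup a y ≡ lookup a′ y) →
             ∀ w → embed a σ w ≡ embed a′ σ w
embed-cong {a = a} {a′} {σ} σ-inj agree w = vec-ext _ _ pointwise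
  where
  pointwise : ∀ y → lookup (embed a σ w) y ≡ lookup (embed a′ σ w) y
  pointwise y with Finₚ.any? (λ j → σ j Finₚ.≟ y)
  ... | yes (j , refl) = trans (lookup-embed a σ-inj w j) (sym (lookup-embed a′ σ-inj w j))
  ... | no y∉σ         = trans (lookup-embed-∉ a σ w (curry y∉σ))
                          (trans (agree y (curry y∉σ)) (sym (lookup-embed-∉ a′ σ w (curry y∉σ))))

MinimisesChanges : Coloring n → Vertex n → Vertex n → List (Fin n) → Set
MinimisesChanges c a b ds = ∀ ds′ → IsGeodesic a b ds′ → cc c a ds ≤ cc c a ds′

TieBreak : Coloring n → Vertex n → Vertex n → Maybe Bool → List (Fin n) → Set
TieBreak c a b col Q =
  (∃ λ ds → IsGeodesic a b ds × MinimisesChanges c a b ds × firstCol c a ds ≡ col) → firstCol c a Q ≡ col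

tieBreak-nothing : ∀ {c : Coloring n} {a b} Q → IsGeodesic a b Q → TieBreak c a b nothing Q
tieBreak-nothing []      _                _                     = refl
tieBreak-nothing (i ∷ Q) (_ , shortest) ([] , []-geo , _)     with shortest [] (proj₁ []-geo)
... | ()
tieBreak-nothing (i ∷ Q) _              (j ∷ ds , _ , _ , ())

⊓-pred-suc : ∀ s M → (+ s) ℤ.⊓ ((+ M) ℤ.- (+ 1)) ℤ.+ + 1 ≡ + (suc s ⊓ M)
⊓-pred-suc s zero    = refl
⊓-pred-suc s (suc M) = cong +_ (+-comm (s ⊓ M) 1)

module Subcube (c : Coloring n) {σ : Fin k → Fin n} (σ-inj : Injective _≡_ _≡_ σ)
               {a b : Vertex n} (σ-geodesic : IsGeodesic a b (map σ (allFin k))) where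

  c′ : Coloring k
  c′ = restrict c σ a

  w₀ : Vertex k
  w₀ = localCoords σ a

  flipV-embed : ∀ w j → flipV (embed a σ w) (σ j) ≡ embed a σ (flipV w j)
  flipV-embed w j = trans (cong (λ x → embed a σ w [ σ j ]≔ not x) (lookup-embed a σ-inj w j))
                          (sym (embed-update a σ-inj w j _))

  endV-embed : ∀ w ds → endV (embed a σ w) (map σ ds) ≡ embed a σ (endV w ds)
  endV-embed w []       = refl
  endV-embed w (j ∷ ds) = trans (cong (λ v → endV v (map σ ds)) (flipV-embed w j)) (endV-embed (flipV w j) ds)

  colors-embed : ∀ w ds → colors c (embed a σ w) (map σ ds) ≡ colors c′ w ds
  colors-embed w []       = refl
  colors-embed w (j ∷ ds) = cong₂ _∷_ (sym (cong (λ v → c v (σ j)) (embed-update a σ-inj w j false)))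
    (trans (cong (λ v → colors c v (map σ ds)) (flipV-embed w j)) (colors-embed (flipV w j) ds))

  endV-map : ∀ ds → endV a (map σ ds) ≡ embed a σ (endV w₀ ds)
  endV-map ds =
    subst (λ v → endV v (map σ ds) ≡ embed a σ (endV w₀ ds)) (embed-localCoords a σ) (endV-embed w₀ ds)

  colors-map : ∀ ds → colors c a (map σ ds) ≡ colors c′ w₀ ds
  colors-map ds =
    subst (λ v → colors c v (map σ ds) ≡ colors c′ w₀ ds) (embed-localCoords a σ) (colors-embed w₀ ds)

  embed-compl : embed a σ (compl w₀) ≡ b
  embed-compl = trans (cong (embed a σ) (sym (endV-allFin w₀))) (trans (sym (endV-map (allFin k))) (proj₁ σ-geodesic))

  dist≡k : dist a b ≡ k
  dist≡k = trans (sym (IsGeodesic⇒length≡dist (map σ (allFin k)) σ-geodesic))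
                 (trans (Listₚ.length-map σ (allFin k)) (Listₚ.length-tabulate (λ j → j)))

  lift : ∀ ds → AGeo w₀ ds → IsGeodesic a b (map σ ds)
  lift ds geo = length≡dist⇒IsGeodesic (map σ ds)
    (trans (endV-map ds) (trans (cong (embed a σ) (proj₁ (AGeo⇒ ds geo))) embed-compl))
    (trans (Listₚ.length-map σ ds) (trans (proj₂ (AGeo⇒ ds geo)) (sym dist≡k)))

  unlift : ∀ ds′ → IsGeodesic a b ds′ → ∃ λ ds → ds′ ≡ map σ ds × AGeo w₀ ds
  unlift ds′ geo with preimage ds′ (All.map in-image (proj₂ (geodesic-directions ds′ geo)))
    where
    in-image : ∀ {y} → lookup a y ≢ lookup b y → ∃ λ j → σ j ≡ y
    in-image {y} differs with Finₚ.any? (λ j → σ j Finₚ.≟ y)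
    ... | yes found = found
    ... | no y∉σ    = ⊥-elim (differs (sym (trans (cong (λ v → lookup v y) (sym embed-compl))
                                                   (lookup-embed-∉ a σ (compl w₀) (curry y∉σ)))))
    preimage : ∀ ys → All (λ y → ∃ λ j → σ j ≡ y) ys → ∃ λ ds → ys ≡ map σ ds
    preimage []       []                 = [] , refl
    preimage (y ∷ ys) ((j , refl) ∷ pre) = let ds , eq = preimage ys pre in j ∷ ds , cong (σ j ∷_) eq
  ... | ds , refl = ds , refl , AGeo⇐ ds
    (embed-injective a σ-inj (trans (sym (endV-map ds)) (trans (proj₁ geo) (sym embed-compl))))
    (trans (sym (Listₚ.length-map σ ds)) (trans (IsGeodesic⇒length≡dist ds′ geo) dist≡k))

  cc-map : ∀ ds → cc c a (map σ ds) ≡ cc c′ w₀ ds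
  cc-map ds = cong changes (colors-map ds)

  firstCol-map : ∀ ds → firstCol c a (map σ ds) ≡ firstCol c′ w₀ ds
  firstCol-map ds = cong head (colors-map ds)

  module _ {t} (value : GVal c′ w₀ t) {Q} (Q-minimal : MinimisesChanges c a b Q) where

    private
      s : ℕ
      s = proj₁ value
      s-min : MinOver (AGeo w₀) (cc c′ w₀) s
      s-min = proj₁ (proj₂ value)

    s≤cc : ∀ ds′ → IsGeodesic a b ds′ → s ≤ cc c a ds′
    s≤cc ds′ geo with unlift ds′ geo
    ... | ds , refl , ds-geo = ≤-trans (proj₂ s-min ds ds-geo) (≤-reflexive (sym (cc-map ds)))

    cc≤s : cc c a Q ≤ s
    cc≤s = let ds , ds-geo , cc≡s = proj₁ s-min in
      ≤-trans (Q-minimal (map σ ds) (lift ds ds-geo)) (≤-reflexive (trans (cc-map ds) cc≡s))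

    firstCol≡ : ∀ {col sx} → MinOver (AGeoCol c′ w₀ col) (cc c′ w₀) sx → sx ≤ s →
                TieBreak c a b (just col) Q → firstCol c a Q ≡ just col
    firstCol≡ ((ds , (ds-geo , first) , cc≡sx) , _) sx≤s tie = tie
      (map σ ds , lift ds ds-geo ,
       (λ ds′ geo′ → ≤-trans (≤-reflexive (trans (cc-map ds) cc≡sx)) (≤-trans sx≤s (s≤cc ds′ geo′))) ,
       trans (firstCol-map ds) first)

    s≤min : ∀ {col sx} → MinOver (AGeoCol c′ w₀ col) (cc c′ w₀) sx → s ≤ sx
    s≤min ((ds , (ds-geo , _) , cc≡sx) , _) = ≤-trans (proj₂ s-min ds ds-geo) (≤-reflexive cc≡sx)

    cost≤1+s : ∀ col → changeBetween col (firstCol c a Q) + cc c a Q ≤ suc s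
    cost≤1+s col = +-mono-≤ (changeBetween≤1 col _) cc≤s

    chunk-cost : ∀ col → TieBreak c a b col Q → + (changeBetween col (firstCol c a Q) + cc c a Q) ℤ.≤ t ℤ.+ + 1
    chunk-cost col tie with proj₂ (proj₂ value)
    ... | inj₂ (_ , t≡s) =
      subst (λ t → _ ℤ.≤ t ℤ.+ + 1) (sym t≡s)
            (ℤ.+≤+ (≤-trans (cost≤1+s col) (≤-reflexive (+-comm 1 s))))
    ... | inj₁ (sr , sb , r-min , b-min , t≡) =
      subst (_ ℤ.≤_) (sym (trans (cong (ℤ._+ + 1) t≡) (⊓-pred-suc s (sr ⊔ sb))))
            (ℤ.+≤+ (⊓-glb (cost≤1+s col) cost≤max))
      where
      no-change : sr ⊔ sb ≤ s → ∀ col → TieBreak c a b col Q → changeBetween col (firstCol c a Q) ≡ 0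
      no-change max≤s nothing      _   = refl
      no-change max≤s (just true)  tie rewrite firstCol≡ r-min (≤-trans (m≤m⊔n sr sb) max≤s) tie = refl
      no-change max≤s (just false) tie rewrite firstCol≡ b-min (≤-trans (m≤n⊔m sr sb) max≤s) tie = refl
      cost≤max : changeBetween col (firstCol c a Q) + cc c a Q ≤ sr ⊔ sb
      cost≤max with sr ⊔ sb ≤? s
      ... | no  max≰s = ≤-trans (cost≤1+s col) (≰⇒> max≰s)
      ... | yes max≤s = begin
        changeBetween col (firstCol c a Q) + cc c a Q   ≡⟨ cong (_+ cc c a Q) (no-change max≤s col tie) ⟩
        cc c a Q                                        ≤⟨ cc≤s ⟩
        s                                               ≤⟨ s≤min r-min ⟩
        sr                                              ≤⟨ m≤m⊔n sr sb ⟩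
        sr ⊔ sb                                         ∎
        where open ≤-Reasoning

∑ : List A → (A → ℤ) → ℤ
∑ xs f = sumℤ (map f xs)

∑-cong : ∀ (xs : List A) {f g : A → ℤ} → (∀ x → f x ≡ g x) → ∑ xs f ≡ ∑ xs g
∑-cong xs f≗g = cong sumℤ (Listₚ.map-cong f≗g xs)

∑-+ : ∀ (xs : List A) (f g : A → ℤ) → ∑ xs (λ x → f x ℤ.+ g x) ≡ ∑ xs f ℤ.+ ∑ xs g
∑-+ []       f g = refl
∑-+ (x ∷ xs) f g =
  trans (cong (ℤ._+_ (f x ℤ.+ g x)) (∑-+ xs f g))
        (CommSemigroupₚ.interchange ℤₚ.+-commutativeSemigroup (f x) (g x) _ _)

∑-const : ∀ (xs : List A) C → ∑ xs (λ _ → C) ≡ + length xs ℤ.* C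
∑-const []       C = sym (ℤₚ.*-zeroˡ C)
∑-const (x ∷ xs) C = begin
  C ℤ.+ ∑ xs (λ _ → C)                ≡⟨ cong (ℤ._+_ C) (∑-const xs C) ⟩
  C ℤ.+ + length xs ℤ.* C             ≡⟨ cong (ℤ._+ + length xs ℤ.* C) (ℤₚ.*-identityˡ C) ⟨
  + 1 ℤ.* C ℤ.+ + length xs ℤ.* C     ≡⟨ ℤₚ.*-distribʳ-+ C (+ 1) (+ length xs) ⟨
  + suc (length xs) ℤ.* C             ∎
  where open ≡-Reasoning

∑-*ˡ : ∀ (xs : List A) C (f : A → ℤ) → ∑ xs (λ x → C ℤ.* f x) ≡ C ℤ.* ∑ xs f
∑-*ˡ []       C f = sym (ℤₚ.*-zeroʳ C)
∑-*ˡ (x ∷ xs) C f = trans (cong (ℤ._+_ (C ℤ.* f x)) (∑-*ˡ xs C f)) (sym (ℤₚ.*-distribˡ-+ C (f x) _))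

∑-mono-≤ : ∀ (xs : List A) {f g : A → ℤ} → (∀ {x} → x ∈ xs → f x ℤ.≤ g x) → ∑ xs f ℤ.≤ ∑ xs g
∑-mono-≤ []       f≤g = ℤₚ.≤-refl
∑-mono-≤ (x ∷ xs) f≤g = ℤₚ.+-mono-≤ (f≤g (here refl)) (∑-mono-≤ xs (f≤g ∘ there))

∑-swap : ∀ (xs : List A) (ys : List B) (f : A → B → ℤ) →
         ∑ xs (λ x → ∑ ys (f x)) ≡ ∑ ys (λ y → ∑ xs (λ x → f x y))
∑-swap []       ys f = sym (trans (∑-const ys (+ 0)) (ℤₚ.*-zeroʳ (+ length ys)))
∑-swap (x ∷ xs) ys f = trans (cong (ℤ._+_ (∑ ys (f x))) (∑-swap xs ys f)) (sym (∑-+ ys (f x) _))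

∑-↭ : ∀ {xs ys : List A} (f : A → ℤ) → xs ↭ ys → ∑ xs f ≡ ∑ ys f
∑-↭ f xs↭ys = foldr-commMonoid +-0.setoid +-0.isCommutativeMonoid (↭⇒↭ₛ (Permₚ.map⁺ f xs↭ys))
  where module +-0 = CommutativeMonoid ℤₚ.+-0-commutativeMonoid

∑-involution : ∀ (xs : List A) (ρ : A → A) → Unique xs → (∀ x → ρ (ρ x) ≡ x) →
               (∀ {x} → x ∈ xs → ρ x ∈ xs) →
               ∀ (f : A → ℤ) → ∑ xs (f ∘ ρ) ≡ ∑ xs f
∑-involution xs ρ xs-unique ρ-involutive ρ-closed f = begin
  ∑ xs (f ∘ ρ)
    ≡⟨ cong sumℤ (Listₚ.map-∘ xs) ⟩
  ∑ (map ρ xs) f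
    ≡⟨ ∑-↭ f (∼bag⇒↭ (unique∧set⇒bag map-unique xs-unique (mk⇔ to from))) ⟩
  ∑ xs f ∎
  where
  open ≡-Reasoning
  map-unique : Unique (map ρ xs)
  map-unique = Uniqueₚ.map⁺ (λ {x} {y} eq → trans (sym (ρ-involutive x)) (trans (cong ρ eq) (ρ-involutive y))) xs-unique
  to : ∀ {x} → x ∈ map ρ xs → x ∈ xs
  to x∈ with ∈-map⁻ ρ x∈
  ... | y , y∈xs , refl = ρ-closed y∈xs
  from : ∀ {x} → x ∈ xs → x ∈ map ρ xs
  from {x} x∈xs = subst (_∈ map ρ xs) (ρ-involutive x) (∈-map⁺ ρ (ρ-closed x∈xs))

∑-+-const : ∀ (xs : List A) (f : A → ℤ) C → ∑ xs (λ x → f x ℤ.+ C) ≡ ∑ xs f ℤ.+ + length xs ℤ.* C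
∑-+-const xs f C = trans (∑-+ xs f (λ _ → C)) (cong (ℤ._+_ (∑ xs f)) (∑-const xs C))

+-sum : ∀ (xs : List A) (f : A → ℕ) → + sum (map f xs) ≡ ∑ xs (λ x → + f x)
+-sum []       f = refl
+-sum (x ∷ xs) f = trans (ℤₚ.pos-+ (f x) _) (cong (ℤ._+_ (+ f x)) (+-sum xs f))

allVerts-complete : ∀ (v : Vertex n) → v ∈ allVerts n
allVerts-complete []          = here refl
allVerts-complete (false ∷ v) = ∈-++⁺ˡ (∈-map⁺ (false ∷_) (allVerts-complete v))
allVerts-complete (true ∷ v)  = ∈-++⁺ʳ _ (∈-map⁺ (true ∷_) (allVerts-complete v))

allVerts-unique : ∀ n → Unique (allVerts n)
allVerts-unique zero    = [] ∷ []
allVerts-unique (suc n) =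
  Uniqueₚ.++⁺ (Uniqueₚ.map⁺ ∷-injectiveʳ (allVerts-unique n)) (Uniqueₚ.map⁺ ∷-injectiveʳ (allVerts-unique n))
              disjoint
  where
  ∷-injectiveʳ : ∀ {x : Bool} {u v : Vertex n} → x ∷ u ≡ x ∷ v → u ≡ v
  ∷-injectiveʳ refl = refl
  disjoint : ∀ {v} → v ∈ map (false ∷_) (allVerts n) × v ∈ map (true ∷_) (allVerts n) → ⊥
  disjoint (v∈false , v∈true) with ∈-map⁻ (false ∷_) v∈false | ∈-map⁻ (true ∷_) v∈true
  ... | _ , _ , refl | _ , _ , ()

length-allVerts : ∀ n → length (allVerts n) ≡ 2 ^ n
length-allVerts zero    = refl
length-allVerts (suc n) = begin
  length (map (false ∷_) (allVerts n) ++ map (true ∷_) (allVerts n))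
    ≡⟨ Listₚ.length-++ (map (false ∷_) (allVerts n)) ⟩
  length (map (false ∷_) (allVerts n)) + length (map (true ∷_) (allVerts n))
    ≡⟨ cong₂ _+_ (Listₚ.length-map (false ∷_) (allVerts n)) (Listₚ.length-map (true ∷_) (allVerts n)) ⟩
  length (allVerts n) + length (allVerts n)
    ≡⟨ cong (λ l → l + l) (length-allVerts n) ⟩
  2 ^ n + 2 ^ n
    ≡⟨ cong (_+_ (2 ^ n)) (+-identityʳ (2 ^ n)) ⟨
  2 * 2 ^ n ∎
  where open ≡-Reasoning

-- Chunks of an antipodal geodesic

-- d is only a default for nthOr: chunks of antipodal geodesics have exactly k directions.
module Chunks {n k : ℕ} (d : Fin n) (c : Coloring n) where

  Path : Set
  Path = Vertex n × List (Fin n)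

  chunk : List (Fin n) → ℕ → List (Fin n)
  chunk ds i = take k (drop (k * i) ds)

  chunkDirection : List (Fin n) → ℕ → Fin k → Fin n
  chunkDirection ds i = nthOr d (chunk ds i) ∘ toℕ

  corner : Path → ℕ → Vertex n
  corner (u , ds) i = vtx u ds (k * i)

  localColoring : Path → ℕ → Coloring k
  localColoring (u , ds) i = restrict c (chunkDirection ds i) (corner (u , ds) i)

  localVertex : Path → ℕ → Vertex k
  localVertex (u , ds) i = localCoords (chunkDirection ds i) (corner (u , ds) i)

  chunkValue : Path → ℕ → ℤ
  chunkValue P i = proj₁ (gval (localColoring P i) (localVertex P i))

  offset : List (Fin n) → ℕ → Vertex k → Vertex n
  offset ds i = embed (replicate n false) (chunkDirection ds i)

  translate : Vertex k → ℕ → Path → Path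
  translate x i (u , ds) = u ⊕ offset ds i x , ds

  translate-involutive : ∀ x i P → translate x i (translate x i P) ≡ P
  translate-involutive x i (u , ds) = cong (_, ds) (⊕-involutive u (offset ds i x))

  translate-antipodal : ∀ x i {P} → IsAntipodalGeodesic P → IsAntipodalGeodesic (translate x i P)
  translate-antipodal x i {u , ds} geo =
    subst (λ v → IsGeodesic (u ⊕ offset ds i x) v ds) (sym (compl-⊕ u (offset ds i x)))
          (geodesic-⊕ {ds = ds} (offset ds i x) geo)

  module ChunkOf {u : Vertex n} {ds : List (Fin n)} (geo : IsAntipodalGeodesic (u , ds)) {i} (fits : k * suc i ≤ n) where

    private
      σ : Fin k → Fin n
      σ = chunkDirection ds i

    length-chunk : length (chunk ds i) ≡ k
    length-chunk = begin
      length (take k (drop (k * i) ds))   ≡⟨ Listₚ.length-take k (drop (k * i) ds) ⟩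
      k ⊓ length (drop (k * i) ds)        ≡⟨ cong (k ⊓_) (Listₚ.length-drop (k * i) ds) ⟩
      k ⊓ (length ds ∸ k * i)             ≡⟨ m≤n⇒m⊓n≡m k≤rest ⟩
      k                                   ∎
      where
      open ≡-Reasoning
      k≤rest : k ≤ length ds ∸ k * i
      k≤rest = m+n≤o⇒m≤o∸n k (≤-trans (≤-reflexive (sym (*-suc k i)))
                 (≤-trans fits (≤-reflexive (sym (trans (IsGeodesic⇒length≡dist ds geo) (dist-compl u))))))

    chunkDirection-injective : Injective _≡_ _≡_ σ
    chunkDirection-injective {j} {j′} eq = Finₚ.toℕ-injective
      (nthOr-injective d chunk-unique (index< j) (index< j′) eq)
      where
      chunk-unique : Unique (chunk ds i)
      chunk-unique = Uniqueₚ.take⁺ k (Uniqueₚ.drop⁺ (k * i) (proj₁ (geodesic-directions ds geo)))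
      index< : ∀ j → toℕ j < length (chunk ds i)
      index< j = subst (toℕ j <_) (sym length-chunk) (Finₚ.toℕ<n j)

    chunk-geodesic : IsGeodesic (corner (u , ds) i) (corner (u , ds) (suc i)) (map σ (allFin k))
    chunk-geodesic = subst₂ (IsGeodesic (corner (u , ds) i))
      (cong (λ p → vtx u ds p) (trans (+-comm (k * i) k) (sym (*-suc k i))))
      (sym (trans (Listₚ.map-tabulate (λ j → j) σ) (tabulate-nthOr d (chunk ds i) length-chunk)))
      (infix-geodesic geo (k * i) k)

    open Subcube c chunkDirection-injective chunk-geodesic public

    private
      a : Vertex n
      a = corner (u , ds) i
      z : Vertex k → Vertex n
      z = offset ds i

    corner-translate : ∀ x → corner (translate x i (u , ds)) i ≡ a ⊕ z x
    corner-translate x = endV-⊕ u (z x) (take (k * i) ds)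

    embed-translate : ∀ x w → embed (a ⊕ z x) σ w ≡ embed a σ w
    embed-translate x = embed-cong chunkDirection-injective λ y y∉σ → begin
      lookup (a ⊕ z x) y                  ≡⟨ Vecₚ.lookup-zipWith _xor_ y a (z x) ⟩
      lookup a y xor lookup (z x) y       ≡⟨ cong (lookup a y xor_) (lookup-embed-∉ (replicate n false) σ x y∉σ) ⟩
      lookup a y xor lookup (replicate n false) y ≡⟨ cong (lookup a y xor_) (Vecₚ.lookup-replicate y false) ⟩
      lookup a y xor false                ≡⟨ xor-identityʳ (lookup a y) ⟩
      lookup a y                          ∎
      where open ≡-Reasoning

    localColoring-translate : ∀ x w j → localColoring (translate x i (u , ds)) i w j ≡ localColoring (u , ds) i w j
    localColoring-translate x w j =
      cong (λ v → c v (σ j)) (trans (cong (λ v → embed v σ w) (corner-translate x)) (embed-translate x w))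

    localVertex-translate : ∀ x → localVertex (translate x i (u , ds)) i ≡ localVertex (u , ds) i ⊕ x
    localVertex-translate x = vec-ext _ _ λ j → begin
      lookup (localVertex (translate x i (u , ds)) i) j
        ≡⟨ Vecₚ.lookup∘tabulate _ j ⟩
      lookup (corner (translate x i (u , ds)) i) (σ j)
        ≡⟨ cong (λ v → lookup v (σ j)) (corner-translate x) ⟩
      lookup (a ⊕ z x) (σ j)
        ≡⟨ Vecₚ.lookup-zipWith _xor_ (σ j) a (z x) ⟩
      lookup a (σ j) xor lookup (z x) (σ j)
        ≡⟨ cong (lookup a (σ j) xor_) (lookup-embed (replicate n false) chunkDirection-injective x j) ⟩
      lookup a (σ j) xor lookup x j
        ≡⟨ cong (_xor lookup x j) (Vecₚ.lookup∘tabulate (lookup a ∘ σ) j) ⟨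
      lookup (localVertex (u , ds) i) j xor lookup x j
        ≡⟨ Vecₚ.lookup-zipWith _xor_ j (localVertex (u , ds) i) x ⟨
      lookup (localVertex (u , ds) i ⊕ x) j ∎
      where open ≡-Reasoning

    GVal-translate : ∀ x → GVal c′ (w₀ ⊕ x) (chunkValue (translate x i (u , ds)) i)
    GVal-translate x = subst (λ w → GVal c′ w (chunkValue (translate x i (u , ds)) i)) (localVertex-translate x)
      (GVal-cong (localColoring-translate x) (proj₂ (gval _ _)))

    ∑-translate≤ : ∀ {F} → IsFhatNum k F →
                   ∑ (allVerts k) (λ x → chunkValue (translate x i (u , ds)) i) ℤ.≤ F
    ∑-translate≤ {F} (_ , F-max) = begin
      ∑ (allVerts k) (λ x → chunkValue (translate x i (u , ds)) i)
        ≡⟨ ∑-cong (allVerts k) (λ x → cong (λ v → chunkValue (translate v i (u , ds)) i) (sym (⊕-cancelˡ w₀ x))) ⟩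
      ∑ (allVerts k) (g ∘ (w₀ ⊕_))
        ≡⟨ ∑-involution (allVerts k) (w₀ ⊕_) (allVerts-unique k) (⊕-cancelˡ w₀) (λ _ → allVerts-complete _) g ⟩
      ∑ (allVerts k) g
        ≤⟨ F-max c′ g (λ w → subst (λ v → GVal c′ v (g w)) (⊕-cancelˡ w₀ w) (GVal-translate (w₀ ⊕ w))) ⟩
      F ∎
      where
      open ℤₚ.≤-Reasoning
      g : Vertex k → ℤ
      g w = chunkValue (translate (w₀ ⊕ w) i (u , ds)) i

  module Outcome .{{_ : NonZero k}} {u : Vertex n} {ds : List (Fin n)} (geo : IsAntipodalGeodesic (u , ds))
                 {m} (km≤n : k * m ≤ n) {Q : ℕ → List (Fin n)} (valid : ValidOutcome c k m (u , ds) Q) where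

    open SegmentedWalk c (corner (u , ds)) Q

    private
      P : Path
      P = (u , ds)

      optimal : ∀ i → i < m → IsGeodesic (corner P i) (corner P (suc i)) (Q i) ×
                              MinimisesChanges c (corner P i) (corner P (suc i)) (Q i)
      optimal = proj₁ valid

      fits : ∀ {i} → i < m → k * suc i ≤ n
      fits i<m = ≤-trans (*-monoʳ-≤ k i<m) km≤n

    linked : Linked m
    linked i i<m = proj₁ (proj₁ (optimal i i<m)) , λ Qi≡[] → ≢-nonZero⁻¹ k
      (trans (sym (ChunkOf.dist≡k geo (fits i<m)))
        (trans (sym (IsGeodesic⇒length≡dist (Q i) (proj₁ (optimal i i<m)))) (cong length Qi≡[])))

    tie-breaks : ∀ {i} → i < m → TieBreak c (corner P i) (corner P (suc i)) (colourBefore i) (Q i)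
    tie-breaks {zero}  0<m     = tieBreak-nothing (Q 0) (proj₁ (optimal 0 0<m))
    tie-breaks {suc i} suc-i<m = proj₂ valid i suc-i<m

    segmentCost≤ : ∀ {i} → i < m → + segmentCost i ℤ.≤ chunkValue P i ℤ.+ + 1
    segmentCost≤ {i} i<m = ChunkOf.chunk-cost geo (fits i<m) (proj₂ (gval _ _))
      (proj₂ (optimal i i<m)) (colourBefore i) (tie-breaks i<m)

    resultCC≤ : resultCC c k m P Q ≤ sum (map segmentCost (upTo m)) + (n ∸ k * m)
    resultCC≤ = begin
      cc c u (firstSegments m ++ tail)              ≡⟨ cong (λ v → cc c v (firstSegments m ++ tail)) corner-zero ⟨
      cc c (corner P 0) (firstSegments m ++ tail)   ≤⟨ cc-concat-++ m tail linked ⟩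
      sum (map segmentCost (upTo m)) + length tail  ≡⟨ cong (_+_ (sum (map segmentCost (upTo m)))) length-tail ⟩
      sum (map segmentCost (upTo m)) + (n ∸ k * m)  ∎
      where
      open ≤-Reasoning
      tail : List (Fin n)
      tail = drop (k * m) ds
      corner-zero : corner P 0 ≡ u
      corner-zero = cong (λ p → endV u (take p ds)) (*-zeroʳ k)
      length-tail : length tail ≡ n ∸ k * m
      length-tail = trans (Listₚ.length-drop (k * m) ds)
                          (cong (_∸ k * m) (trans (IsGeodesic⇒length≡dist ds geo) (dist-compl u)))

    pathwise-bound : + resultCC c k m P Q ℤ.≤ ∑ (upTo m) (chunkValue P) ℤ.+ + (m + (n ∸ k * m))
    pathwise-bound = begin
      + resultCC c k m P Q
        ≤⟨ ℤ.+≤+ resultCC≤ ⟩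
      + (sum (map segmentCost (upTo m)) + r)
        ≡⟨ ℤₚ.pos-+ (sum (map segmentCost (upTo m))) r ⟩
      + sum (map segmentCost (upTo m)) ℤ.+ + r
        ≡⟨ cong (ℤ._+ + r) (+-sum (upTo m) segmentCost) ⟩
      ∑ (upTo m) (λ i → + segmentCost i) ℤ.+ + r
        ≤⟨ ℤₚ.+-monoˡ-≤ (+ r) (∑-mono-≤ (upTo m) (segmentCost≤ ∘ ∈-upTo⁻)) ⟩
      ∑ (upTo m) (λ i → chunkValue P i ℤ.+ + 1) ℤ.+ + r
        ≡⟨ cong (ℤ._+ + r) (∑-+-const (upTo m) (chunkValue P) (+ 1)) ⟩
      ∑ (upTo m) (chunkValue P) ℤ.+ + length (upTo m) ℤ.* + 1 ℤ.+ + r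
        ≡⟨ cong (λ l → ∑ (upTo m) (chunkValue P) ℤ.+ l ℤ.+ + r) (trans (ℤₚ.*-identityʳ _) (cong +_ (Listₚ.length-upTo m))) ⟩
      ∑ (upTo m) (chunkValue P) ℤ.+ + m ℤ.+ + r
        ≡⟨ ℤₚ.+-assoc (∑ (upTo m) (chunkValue P)) (+ m) (+ r) ⟩
      ∑ (upTo m) (chunkValue P) ℤ.+ + (m + r) ∎
      where
      open ℤₚ.≤-Reasoning
      r : ℕ
      r = n ∸ k * m

  ∑-chunkValue≤ : ∀ {Ps : List Path} → Unique Ps → (∀ P → (P ∈ Ps) ⇔ IsAntipodalGeodesic P) →
                  ∀ {F} → IsFhatNum k F → ∀ {i} → k * suc i ≤ n →
                  + (2 ^ k) ℤ.* ∑ Ps (λ P → chunkValue P i) ℤ.≤ + length Ps ℤ.* F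
  ∑-chunkValue≤ {Ps} Ps-unique Ps-antipodal {F} F-max {i} fits = begin
    + (2 ^ k) ℤ.* ∑ Ps t
      ≡⟨ cong (λ l → + l ℤ.* ∑ Ps t) (length-allVerts k) ⟨
    + length (allVerts k) ℤ.* ∑ Ps t
      ≡⟨ ∑-const (allVerts k) (∑ Ps t) ⟨
    ∑ (allVerts k) (λ _ → ∑ Ps t)
      ≡⟨ ∑-cong (allVerts k) (λ x → sym (∑-involution Ps (translate x i) Ps-unique (translate-involutive x i) (closed x) t)) ⟩
    ∑ (allVerts k) (λ x → ∑ Ps (t ∘ translate x i))
      ≡⟨ ∑-swap (allVerts k) Ps (λ x P → t (translate x i P)) ⟩
    ∑ Ps (λ P → ∑ (allVerts k) (λ x → t (translate x i P)))
      ≤⟨ ∑-mono-≤ Ps (λ {P} P∈Ps → ChunkOf.∑-translate≤ {proj₁ P} {proj₂ P} (to P∈Ps) fits F-max) ⟩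
    ∑ Ps (λ _ → F)
      ≡⟨ ∑-const Ps F ⟩
    + length Ps ℤ.* F ∎
    where
    open ℤₚ.≤-Reasoning
    t : Path → ℤ
    t P = chunkValue P i
    to : ∀ {P} → P ∈ Ps → IsAntipodalGeodesic P
    to {P} = Equivalence.to (Ps-antipodal P)
    closed : ∀ x {P} → P ∈ Ps → translate x i P ∈ Ps
    closed x {P} P∈Ps = Equivalence.from (Ps-antipodal (translate x i P)) (translate-antipodal x i (to P∈Ps))

  module _ .{{_ : NonZero k}} {Ps : List Path} (Ps-unique : Unique Ps)
           (Ps-antipodal : ∀ P → (P ∈ Ps) ⇔ IsAntipodalGeodesic P) {m} (km≤n : k * m ≤ n)
           (R : Path → ℕ → List (Fin n)) (valid : ∀ P → P ∈ Ps → ValidOutcome c k m P (R P)) where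

    ∑-resultCC≤ : ∑ Ps (λ P → + resultCC c k m P (R P))
                    ℤ.≤ ∑ (upTo m) (λ i → ∑ Ps (λ P → chunkValue P i)) ℤ.+ + length Ps ℤ.* + (m + (n ∸ k * m))
    ∑-resultCC≤ = begin
      ∑ Ps (λ P → + resultCC c k m P (R P))
        ≤⟨ ∑-mono-≤ Ps (λ {P} P∈Ps →
             Outcome.pathwise-bound (Equivalence.to (Ps-antipodal P) P∈Ps) km≤n (valid P P∈Ps)) ⟩
      ∑ Ps (λ P → ∑ (upTo m) (chunkValue P) ℤ.+ + (m + (n ∸ k * m)))
        ≡⟨ ∑-+ Ps (λ P → ∑ (upTo m) (chunkValue P)) _ ⟩
      ∑ Ps (λ P → ∑ (upTo m) (chunkValue P)) ℤ.+ ∑ Ps (λ _ → + (m + (n ∸ k * m)))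
        ≡⟨ cong₂ ℤ._+_ (∑-swap Ps (upTo m) chunkValue) (∑-const Ps _) ⟩
      ∑ (upTo m) (λ i → ∑ Ps (λ P → chunkValue P i)) ℤ.+ + length Ps ℤ.* + (m + (n ∸ k * m)) ∎
      where open ℤₚ.≤-Reasoning

    ∑∑-chunkValue≤ : ∀ {F} → IsFhatNum k F →
                      + (2 ^ k) ℤ.* ∑ (upTo m) (λ i → ∑ Ps (λ P → chunkValue P i)) ℤ.≤ + m ℤ.* (+ length Ps ℤ.* F)
    ∑∑-chunkValue≤ {F} F-max = begin
      + (2 ^ k) ℤ.* ∑ (upTo m) (λ i → ∑ Ps (λ P → chunkValue P i))
        ≡⟨ ∑-*ˡ (upTo m) (+ (2 ^ k)) _ ⟨
      ∑ (upTo m) (λ i → + (2 ^ k) ℤ.* ∑ Ps (λ P → chunkValue P i))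
        ≤⟨ ∑-mono-≤ (upTo m) (λ i∈ →
             ∑-chunkValue≤ Ps-unique Ps-antipodal F-max (≤-trans (*-monoʳ-≤ k (∈-upTo⁻ i∈)) km≤n)) ⟩
      ∑ (upTo m) (λ _ → + length Ps ℤ.* F)
        ≡⟨ ∑-const (upTo m) _ ⟩
      + length (upTo m) ℤ.* (+ length Ps ℤ.* F)
        ≡⟨ cong (λ l → + l ℤ.* (+ length Ps ℤ.* F)) (Listₚ.length-upTo m) ⟩
      + m ℤ.* (+ length Ps ℤ.* F) ∎
      where open ℤₚ.≤-Reasoning

k*[n/k]≤n : ∀ n k .{{_ : NonZero k}} → k * (n / k) ≤ n
k*[n/k]≤n n k = ≤-trans (≤-reflexive (*-comm k (n / k))) (m/n*n≤m n k)

n∸k*[n/k]≡n%k : ∀ n k .{{_ : NonZero k}} → n ∸ k * (n / k) ≡ n % k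
n∸k*[n/k]≡n%k n k = trans (cong (n ∸_) (*-comm k (n / k))) (sym (m%n≡m∸m/n*n n k))

-- Only k ≥ 1 (NonZero k) is used.
lemma1 : (n k : ℕ) → {{_ : NonZero k}} → 2 ≤ k → k ≤ n →
         (c : Coloring n) →
         (F : ℤ) → IsFhatNum k F →
         (Ps : List (Vertex n × List (Fin n))) → Unique Ps →
         (∀ P → (P ∈ Ps) ⇔ IsAntipodalGeodesic P) →
         (R : Vertex n × List (Fin n) → ℕ → List (Fin n)) →
         (∀ P → P ∈ Ps → ValidOutcome c k (n / k) P (R P)) →
         (+ (2 ^ k)) ℤ.* (+ sum (map (λ P → resultCC c k (n / k) P (R P)) Ps))
           ℤ.≤ (+ length Ps) ℤ.* ((+ (n / k)) ℤ.* F ℤ.+ (+ (2 ^ k * (n / k + n % k))))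
lemma1 n k _ k≤n c F F-max Ps Ps-unique Ps-antipodal R valid = begin
  + (2 ^ k) ℤ.* + sum (map (λ P → resultCC c k m P (R P)) Ps)
    ≡⟨ cong (ℤ._*_ (+ (2 ^ k))) (+-sum Ps (λ P → resultCC c k m P (R P))) ⟩
  + (2 ^ k) ℤ.* ∑ Ps (λ P → + resultCC c k m P (R P))
    ≤⟨ ℤₚ.*-monoˡ-≤-nonNeg (+ (2 ^ k)) (∑-resultCC≤ Ps-unique Ps-antipodal km≤n R valid) ⟩
  + (2 ^ k) ℤ.* (T ℤ.+ L ℤ.* + (m + r′))
    ≡⟨ ℤₚ.*-distribˡ-+ (+ (2 ^ k)) T (L ℤ.* + (m + r′)) ⟩
  + (2 ^ k) ℤ.* T ℤ.+ + (2 ^ k) ℤ.* (L ℤ.* + (m + r′))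
    ≤⟨ ℤₚ.+-monoˡ-≤ _ (∑∑-chunkValue≤ Ps-unique Ps-antipodal km≤n R valid F-max) ⟩
  + m ℤ.* (L ℤ.* F) ℤ.+ + (2 ^ k) ℤ.* (L ℤ.* + (m + r′))
    ≡⟨ collect (+ m) L F (+ (2 ^ k)) (+ (m + r′)) ⟩
  L ℤ.* (+ m ℤ.* F ℤ.+ + (2 ^ k) ℤ.* + (m + r′))
    ≡⟨ cong (λ x → L ℤ.* (+ m ℤ.* F ℤ.+ x)) (ℤₚ.pos-* (2 ^ k) (m + r′)) ⟨
  L ℤ.* (+ m ℤ.* F ℤ.+ + (2 ^ k * (m + r′)))
    ≡⟨ cong (λ x → L ℤ.* (+ m ℤ.* F ℤ.+ + (2 ^ k * (m + x)))) (n∸k*[n/k]≡n%k n k) ⟩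
  L ℤ.* (+ m ℤ.* F ℤ.+ + (2 ^ k * (m + n % k))) ∎
  where
  open ℤₚ.≤-Reasoning
  open Chunks (fromℕ< (≤-trans (>-nonZero⁻¹ k) k≤n)) c
  m r′ : ℕ
  m = n / k
  r′ = n ∸ k * m
  km≤n : k * m ≤ n
  km≤n = k*[n/k]≤n n k
  L T : ℤ
  L = + length Ps
  T = ∑ (upTo m) (λ i → ∑ Ps (λ P → chunkValue P i))
  collect : ∀ a b x e g → a ℤ.* (b ℤ.* x) ℤ.+ e ℤ.* (b ℤ.* g) ≡ b ℤ.* (a ℤ.* x ℤ.+ e ℤ.* g)
  collect = solve-∀
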